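{- Let $X'$ be a simplicial complex and let $X$ be a subcomplex of $X'$ containing all vertices of $X'$. Let $\mathcal{P}=\{P_{uv}: uv\in X'(1)\}$ be a substitution. Assume that for every triangle $t=\{u,v,w\}\in X'(2)$, the composition $\tilde C_t$ of the $3$-cycle $C_t=(u,v,w,u)$ has an $m$-triangle contraction in $X$. Then for every cycle $C$ in $X'$ that has an $\ell$-triangle contraction in $X'$, the composition cycle $\tilde C$ has an $\ell m$-triangle contraction in $X$.
   Context: A substitution is a set $\mathcal{P}=\{P_{uv}:uv\in X'(1)\}$ where $P_{uv}$ is a path in $X$ from $u$ to $v$ and $P_{uv}=P_{vu}^{ -1}$ ($P^{ -1}$ is the reversed path). For a path $Q=(v_0,\dots,v_m)$ in $X'$, its composition is the path $\tilde Q=P_{v_0v_1}\circ P_{v_1v_2}\circ\cdots\circ P_{v_{m-1}v_m}$ in $X$, where $\circ$ is concatenation. In a complex, relations on paths: (BT) $Q\circ(u,v,u)\circ Q'\sim Q\circ(u)\circ Q'$; (TR) $Q\circ(u,v)\circ Q'\sim Q\circ(u,w,v)\circ Q'$ for triangles $\{u,w,v\}$ of the complex. $P\sim_1P'$ if related by a sequence of such moves with exactly one (TR). An $m$-triangle contraction of a cycle $C$ based at $v_0$ is a sequence $C=C_0,\dots,C_m=(v_0)$ of cycles with $C_i\sim_1C_{i+1}$. -}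

module Defs where

open import Data.Nat using (ℕ; zero; suc)
open import Data.List using (List; []; _∷_; _++_; reverse; drop; [_])
open import Data.Product using (Σ; _×_; _,_)
open import Relation.Binary.PropositionalEquality using (_≡_; _≢_)

-- A simplicial complex, recorded up to dimension 2 (only vertices, edges and
-- triangles are relevant).  Every element of V is a vertex.
record Complex (V : Set) : Set₁ where
  field
    Edge       : V → V → Set
    Tri        : V → V → V → Set
    edge-sym   : ∀ {u v} → Edge u v → Edge v u
    edge-irr   : ∀ {u v} → Edge u v → u ≢ v
    tri-edge   : ∀ {u v w} → Tri u v w → Edge u v
    tri-rot    : ∀ {u v w} → Tri u v w → Tri v w u
    tri-swap   : ∀ {u v w} → Tri u v w → Tri v u w
open Complex public

-- X is a subcomplex of X' (on the same vertex set, so X contains all vertices of X').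
record Subcomplex {V : Set} (X X' : Complex V) : Set where
  field
    sub-edge : ∀ {u v} → Edge X u v → Edge X' u v
    sub-tri  : ∀ {u v w} → Tri X u v w → Tri X' u v w
open Subcomplex public

data IsPath {V : Set} (X : Complex V) : V → V → List V → Set where
  single : ∀ u → IsPath X u u [ u ]
  step   : ∀ {u w v p} → Edge X u w → IsPath X w v (w ∷ p) → IsPath X u v (u ∷ w ∷ p)

IsCycleAt : {V : Set} → Complex V → V → List V → Set
IsCycleAt X v0 C = IsPath X v0 v0 C

-- One (BT) move, in either direction:  Q∘(u,v,u)∘Q' ∼ Q∘(u)∘Q'.
-- As vertex lists, Q = xs ++ [u], Q' = u ∷ ys.
data BT {V : Set} (X : Complex V) : List V → List V → Set where
  bt-contract : ∀ xs ys u v → Edge X u v →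
                BT X (xs ++ u ∷ v ∷ u ∷ ys) (xs ++ u ∷ ys)
  bt-expand   : ∀ xs ys u v → Edge X u v →
                BT X (xs ++ u ∷ ys) (xs ++ u ∷ v ∷ u ∷ ys)

data TR {V : Set} (X : Complex V) : List V → List V → Set where
  tr-expand   : ∀ xs ys u w v → Tri X u w v →
                TR X (xs ++ u ∷ v ∷ ys) (xs ++ u ∷ w ∷ v ∷ ys)
  tr-contract : ∀ xs ys u w v → Tri X u w v →
                TR X (xs ++ u ∷ w ∷ v ∷ ys) (xs ++ u ∷ v ∷ ys)

data BT* {V : Set} (X : Complex V) : List V → List V → Set where
  bt-refl : ∀ p → BT* X p p
  bt-cons : ∀ {p q r} → BT X p q → BT* X q r → BT* X p r

_∼₁[_]_ : {V : Set} → List V → Complex V → List V → Set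
_∼₁[_]_ {V} P X P' =
  Σ (List V) λ A → Σ (List V) λ B → BT* X P A × TR X A B × BT* X B P'

Chain : {V : Set} → Complex V → ℕ → List V → List V → Set
Chain X zero    C D = C ≡ D
Chain {V} X (suc m) C D = Σ (List V) λ C' → (C ∼₁[ X ] C') × Chain X m C' D

HasContraction : {V : Set} → Complex V → ℕ → V → List V → Set
HasContraction X m v0 C = IsCycleAt X v0 C × Chain X m C [ v0 ]

-- A substitution for X' in X: for every edge uv of X' a path P u v in X from u to v,
-- with P v u the reverse of P u v.  (Values of P on non-edges are irrelevant.)
record Substitution {V : Set} (X X' : Complex V) : Set where
  field
    P       : V → V → List V
    P-path  : ∀ {u v} → Edge X' u v → IsPath X u v (P u v)
    P-rev   : ∀ {u v} → Edge X' u v → P v u ≡ reverse (P u v)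
open Substitution public

-- Composition Q̃ = P_{v0v1} ∘ ... ∘ P_{v(m-1)vm}; concatenation identifies the
-- common endpoint, so the first vertex of the second path is dropped.
compose : {V : Set} {X X' : Complex V} → Substitution X X' → List V → List V
compose 𝒫 []            = []
compose 𝒫 (u ∷ [])      = u ∷ []
compose 𝒫 (u ∷ v ∷ rest) = P 𝒫 u v ++ drop 1 (compose 𝒫 (v ∷ rest))

-- Composition with 𝒫 turns every move of a contraction in X' into moves in X.  A (BT) move
-- u,v,u ↦ u becomes the backtrack P_uv ∘ P_vu = P_uv ∘ P_uv⁻¹, which (BT) moves remove.  A (TR)
-- move u,w,v ↦ u,v over a triangle t becomes P_uw ∘ P_wv ↦ P_uv: inserting the backtrack
-- P_uv ∘ P_vu in front of it exhibits the composed triangle C̃_t (based at v) as a subword,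
-- and contracting it with the assumed m triangles leaves P_uv.  Hence each of the ℓ steps
-- costs m triangles, the (BT) moves around a step being absorbed into it.  When m = 0 there
-- can be no triangles at all, since C̃_t always contains the nontrivial path P_uv.
module Submission where

open import Defs
open import Data.Empty using (⊥-elim)
open import Data.List using (List; []; _∷_; _++_; reverse; drop; [_])
open import Data.List.Properties using (++-assoc; ++-identityʳ; ++-monoid; unfold-reverse)
open import Data.Nat using (ℕ; zero; suc; _+_; _*_)
open import Data.Nat.Properties using (+-comm)
open import Data.Product using (∃; _×_; _,_; proj₁; proj₂)
open import Relation.Binary.PropositionalEquality
  using (_≡_; refl; sym; trans; cong; cong₂; subst; subst₂; module ≡-Reasoning)
open import Relation.Nullary using (¬_)
open import Tactic.MonoidSolver using (solve)

module _ {A : Set} where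

  drop-1-∷ʳ-++ : (xs : List A) (x : A) (ys : List A) →
    drop 1 ((xs ++ [ x ]) ++ ys) ≡ drop 1 (xs ++ [ x ]) ++ ys
  drop-1-∷ʳ-++ []       x ys = refl
  drop-1-∷ʳ-++ (_ ∷ xs) x ys = refl

  drop-1-reverse : (u w : A) (s : List A) →
    drop 1 (reverse (u ∷ w ∷ s)) ≡ drop 1 (reverse (w ∷ s)) ++ [ u ]
  drop-1-reverse u w s = begin
    drop 1 (reverse (u ∷ w ∷ s))            ≡⟨ cong (drop 1) (unfold-reverse u (w ∷ s)) ⟩
    drop 1 (reverse (w ∷ s) ++ [ u ])       ≡⟨ cong (λ r → drop 1 (r ++ [ u ])) (unfold-reverse w s) ⟩
    drop 1 ((reverse s ++ [ w ]) ++ [ u ])  ≡⟨ drop-1-∷ʳ-++ (reverse s) w [ u ] ⟩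
    drop 1 (reverse s ++ [ w ]) ++ [ u ]    ≡⟨ cong (λ r → drop 1 r ++ [ u ]) (unfold-reverse w s) ⟨
    drop 1 (reverse (w ∷ s)) ++ [ u ]       ∎
    where open ≡-Reasoning

  ++-in-context : (pre xs ys zs post : List A) →
    (pre ++ xs) ++ ys ++ (zs ++ post) ≡ pre ++ (xs ++ ys ++ zs) ++ post
  ++-in-context _ _ _ _ _ = solve (++-monoid A)

  ++-regroup : (F J v R : List A) → F ++ (J ++ v) ++ R ≡ (F ++ J) ++ v ++ R
  ++-regroup _ _ _ _ = solve (++-monoid A)

  ++-regroup-cycle : (F J v A B C Z : List A) →
    F ++ (J ++ v) ++ A ++ B ++ C ++ Z ≡ (F ++ J) ++ (v ++ A ++ B ++ C ++ []) ++ Z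
  ++-regroup-cycle _ _ _ _ _ _ _ = solve (++-monoid A)

module _ {V : Set} {X : Complex V} where

  path-head : ∀ {a b p} → IsPath X a b p → p ≡ a ∷ drop 1 p
  path-head (single _) = refl
  path-head (step _ _) = refl

  path-∷ʳ : ∀ {a b p} → IsPath X a b p → ∃ λ I → p ≡ I ++ [ b ]
  path-∷ʳ (single _) = [] , refl
  path-∷ʳ (step {u} _ q) with path-∷ʳ q
  ... | I , p≡I∷ʳb = u ∷ I , cong (u ∷_) p≡I∷ʳb

  path-++ : ∀ {a b c p q} → IsPath X a b p → IsPath X b c q → IsPath X a c (p ++ drop 1 q)
  path-++ {c = c} (single a) q = subst (IsPath X a c) (path-head q) q
  path-++ (step e p) q = step e (path-++ p q)

  path-split : ∀ {a b} xs u ys → IsPath X a b (xs ++ u ∷ ys) →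
    IsPath X a u (xs ++ [ u ]) × IsPath X u b (u ∷ ys)
  path-split []           u ys (single _) = single u , single u
  path-split []           u ys (step e p) = single u , step e p
  path-split (x ∷ [])     u ys (step e p) = step e (single u) , p
  path-split (x ∷ y ∷ xs) u ys (step e p) =
    let (p₁ , p₂) = path-split (y ∷ xs) u ys p in step e p₁ , p₂

  path-join : ∀ {a b} xs u ys → IsPath X a u (xs ++ [ u ]) → IsPath X u b (u ∷ ys) →
    IsPath X a b (xs ++ u ∷ ys)
  path-join []           u ys (single _)          q = q
  path-join (x ∷ [])     u ys (step e (single _)) q = step e q
  path-join (x ∷ y ∷ xs) u ys (step e p)          q = step e (path-join (y ∷ xs) u ys p q)

  bt*-trans : ∀ {p q r} → BT* X p q → BT* X q r → BT* X p r
  bt*-trans (bt-refl _)   q↝r = q↝r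
  bt*-trans (bt-cons s r) q↝r = bt-cons s (bt*-trans r q↝r)

  bt-sym : ∀ {p q} → BT X p q → BT X q p
  bt-sym (bt-contract xs ys u v e) = bt-expand xs ys u v e
  bt-sym (bt-expand xs ys u v e)   = bt-contract xs ys u v e

  bt*-sym : ∀ {p q} → BT* X p q → BT* X q p
  bt*-sym (bt-refl _)   = bt-refl _
  bt*-sym (bt-cons s r) = bt*-trans (bt*-sym r) (bt-cons (bt-sym s) (bt-refl _))

  tr-sym : ∀ {p q} → TR X p q → TR X q p
  tr-sym (tr-expand xs ys u w v t)   = tr-contract xs ys u w v t
  tr-sym (tr-contract xs ys u w v t) = tr-expand xs ys u w v t

  ∼₁-sym : ∀ {C D} → C ∼₁[ X ] D → D ∼₁[ X ] C
  ∼₁-sym (A , B , C↝A , A→B , B↝D) = B , A , bt*-sym B↝D , tr-sym A→B , bt*-sym C↝A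

  bt-ctx : ∀ {p q} pre post → BT X p q → BT X (pre ++ p ++ post) (pre ++ q ++ post)
  bt-ctx pre post (bt-contract xs ys u v e) =
    subst₂ (BT X) (++-in-context pre xs _ ys post) (++-in-context pre xs _ ys post)
      (bt-contract (pre ++ xs) (ys ++ post) u v e)
  bt-ctx pre post (bt-expand xs ys u v e) =
    subst₂ (BT X) (++-in-context pre xs _ ys post) (++-in-context pre xs _ ys post)
      (bt-expand (pre ++ xs) (ys ++ post) u v e)

  bt*-ctx : ∀ {p q} pre post → BT* X p q → BT* X (pre ++ p ++ post) (pre ++ q ++ post)
  bt*-ctx pre post (bt-refl _)   = bt-refl _
  bt*-ctx pre post (bt-cons s r) = bt-cons (bt-ctx pre post s) (bt*-ctx pre post r)

  tr-ctx : ∀ {p q} pre post → TR X p q → TR X (pre ++ p ++ post) (pre ++ q ++ post)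
  tr-ctx pre post (tr-expand xs ys u w v t) =
    subst₂ (TR X) (++-in-context pre xs _ ys post) (++-in-context pre xs _ ys post)
      (tr-expand (pre ++ xs) (ys ++ post) u w v t)
  tr-ctx pre post (tr-contract xs ys u w v t) =
    subst₂ (TR X) (++-in-context pre xs _ ys post) (++-in-context pre xs _ ys post)
      (tr-contract (pre ++ xs) (ys ++ post) u w v t)

  ∼₁-ctx : ∀ {C D} pre post → C ∼₁[ X ] D → (pre ++ C ++ post) ∼₁[ X ] (pre ++ D ++ post)
  ∼₁-ctx pre post (A , B , C↝A , A→B , B↝D) =
    _ , _ , bt*-ctx pre post C↝A , tr-ctx pre post A→B , bt*-ctx pre post B↝D

  chain-++ : ∀ m n {C D E} → Chain X m C D → Chain X n D E → Chain X (m + n) C E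
  chain-++ zero    n refl               D⇝E = D⇝E
  chain-++ (suc m) n (C′ , C∼C′ , C′⇝D) D⇝E = C′ , C∼C′ , chain-++ m n C′⇝D D⇝E

  chain-sym : ∀ m {C D} → Chain X m C D → Chain X m D C
  chain-sym zero    refl = refl
  chain-sym (suc m) {C} {D} (C′ , C∼C′ , C′⇝D) =
    subst (λ k → Chain X k D C) (+-comm m 1)
      (chain-++ m 1 (chain-sym m C′⇝D) (C , ∼₁-sym C∼C′ , refl))

  chain-ctx : ∀ n {C D} pre post → Chain X n C D → Chain X n (pre ++ C ++ post) (pre ++ D ++ post)
  chain-ctx zero    pre post refl               = refl
  chain-ctx (suc n) pre post (C′ , C∼C′ , C′⇝D) =
    pre ++ C′ ++ post , ∼₁-ctx pre post C∼C′ , chain-ctx n pre post C′⇝D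

  -- Only chains of positive length absorb (BT) moves: a chain of length 0 is an equality.
  bt*-chain : ∀ {m C C′ D} → BT* X C C′ → Chain X (suc m) C′ D → Chain X (suc m) C D
  bt*-chain C↝C′ (C″ , (A , B , C′↝A , A→B , B↝C″) , C″⇝D) =
    C″ , (A , B , bt*-trans C↝C′ C′↝A , A→B , B↝C″) , C″⇝D

  chain-bt* : ∀ m {C D D′} → Chain X (suc m) C D → BT* X D D′ → Chain X (suc m) C D′
  chain-bt* zero (D , (A , B , C↝A , A→B , B↝D) , refl) D↝D′ =
    _ , (A , B , C↝A , A→B , bt*-trans B↝D D↝D′) , refl
  chain-bt* (suc m) (C′ , C∼C′ , C′⇝D) D↝D′ = C′ , C∼C′ , chain-bt* m C′⇝D D↝D′

  bt-path : ∀ {a b A B} → BT X A B → IsPath X a b A → IsPath X a b B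
  bt-path (bt-contract xs ys u v e) p with path-split xs u (v ∷ u ∷ ys) p
  ... | p₁ , step _ (step _ p₂) = path-join xs u ys p₁ p₂
  bt-path (bt-expand xs ys u v e) p with path-split xs u ys p
  ... | p₁ , p₂ = path-join xs u (v ∷ u ∷ ys) p₁ (step e (step (edge-sym X e) p₂))

  bt*-path : ∀ {a b A B} → BT* X A B → IsPath X a b A → IsPath X a b B
  bt*-path (bt-refl _)   p = p
  bt*-path (bt-cons s r) p = bt*-path r (bt-path s p)

  tr-path : ∀ {a b A B} → TR X A B → IsPath X a b A → IsPath X a b B
  tr-path (tr-expand xs ys u w v t) p with path-split xs u (v ∷ ys) p
  ... | p₁ , step _ p₂ =
    path-join xs u (w ∷ v ∷ ys) p₁ (step (tri-edge X t) (step (tri-edge X (tri-rot X t)) p₂))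
  tr-path (tr-contract xs ys u w v t) p with path-split xs u (w ∷ v ∷ ys) p
  ... | p₁ , step _ (step _ p₂) =
    path-join xs u (v ∷ ys) p₁ (step (edge-sym X (tri-edge X (tri-rot X (tri-rot X t)))) p₂)

  ∼₁-path : ∀ {a b A B} → A ∼₁[ X ] B → IsPath X a b A → IsPath X a b B
  ∼₁-path (_ , _ , A↝A′ , A′→B′ , B′↝B) p = bt*-path B′↝B (tr-path A′→B′ (bt*-path A↝A′ p))

  path-backtrack : ∀ {u v p} → IsPath X u v p → ∀ pre post →
    BT* X (pre ++ p ++ drop 1 (reverse p) ++ post) (pre ++ u ∷ post)
  path-backtrack (single u) pre post = bt-refl _
  path-backtrack (step {u} {w} {_} {s} e q) pre post =
    subst (λ L → BT* X L (pre ++ u ∷ post)) (sym regroup)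
      (bt*-trans (path-backtrack q (pre ++ [ u ]) (u ∷ post)) (bt-cons contract (bt-refl _)))
    where
    R = drop 1 (reverse (w ∷ s))

    contract : BT X ((pre ++ [ u ]) ++ w ∷ u ∷ post) (pre ++ u ∷ post)
    contract = subst (λ L → BT X L (pre ++ u ∷ post)) (sym (++-assoc pre [ u ] (w ∷ u ∷ post)))
      (bt-contract pre post u w e)

    regroup : pre ++ (u ∷ w ∷ s) ++ drop 1 (reverse (u ∷ w ∷ s)) ++ post
            ≡ (pre ++ [ u ]) ++ (w ∷ s) ++ R ++ u ∷ post
    regroup = begin
      pre ++ (u ∷ w ∷ s) ++ drop 1 (reverse (u ∷ w ∷ s)) ++ post
        ≡⟨ cong (λ r → pre ++ (u ∷ w ∷ s) ++ r ++ post) (drop-1-reverse u w s) ⟩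
      pre ++ (u ∷ w ∷ s) ++ (R ++ [ u ]) ++ post
        ≡⟨ cong (λ r → pre ++ (u ∷ w ∷ s) ++ r) (++-assoc R [ u ] post) ⟩
      pre ++ [ u ] ++ (w ∷ s) ++ R ++ u ∷ post
        ≡⟨ ++-assoc pre [ u ] _ ⟨
      (pre ++ [ u ]) ++ (w ∷ s) ++ R ++ u ∷ post
        ∎
      where open ≡-Reasoning

module Composition {V : Set} {X X′ : Complex V} (𝒫 : Substitution X X′) where

  compose-from : V → List V → List V
  compose-from a []       = []
  compose-from a (v ∷ vs) = drop 1 (P 𝒫 a v) ++ compose-from v vs

  -- Agrees with compose on paths of X′, and unlike compose it is compatible with
  -- concatenation without any hypothesis.
  compose′ : List V → List V
  compose′ []       = []
  compose′ (v ∷ vs) = v ∷ compose-from v vs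

  compose≡compose′ : ∀ {a b L} → IsPath X′ a b L → compose 𝒫 L ≡ compose′ L
  compose≡compose′ (single _) = refl
  compose≡compose′ (step {u} {w} {_} {s} e p) =
    trans (cong (λ L → P 𝒫 u w ++ drop 1 L) (compose≡compose′ p))
          (cong (_++ compose-from w s) (path-head (P-path 𝒫 e)))

  compose-path : ∀ {a b L} → IsPath X′ a b L → IsPath X a b (compose 𝒫 L)
  compose-path (single u) = single u
  compose-path (step e p) = path-++ (P-path 𝒫 e) (compose-path p)

  compose-from-++ : ∀ a xs u r →
    compose-from a (xs ++ u ∷ r) ≡ compose-from a (xs ++ [ u ]) ++ compose-from u r
  compose-from-++ a []       u r = cong (_++ compose-from u r) (sym (++-identityʳ (drop 1 (P 𝒫 a u))))
  compose-from-++ a (x ∷ xs) u r =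
    trans (cong (drop 1 (P 𝒫 a x) ++_) (compose-from-++ x xs u r))
          (sym (++-assoc (drop 1 (P 𝒫 a x)) _ _))

  compose′-++ : ∀ xs u r → compose′ (xs ++ u ∷ r) ≡ compose′ (xs ++ [ u ]) ++ compose-from u r
  compose′-++ []       u r = refl
  compose′-++ (h ∷ xs) u r = cong (h ∷_) (compose-from-++ h xs u r)

  compose′-at : ∀ {a} xs u → IsPath X′ a u (xs ++ [ u ]) →
    ∃ λ F → ∀ r → compose′ (xs ++ u ∷ r) ≡ F ++ u ∷ compose-from u r
  compose′-at xs u p with path-∷ʳ (subst (IsPath X _ u) (compose≡compose′ p) (compose-path p))
  ... | F , prefix≡F∷ʳu = F , λ r →
    trans (compose′-++ xs u r)
          (trans (cong (_++ compose-from u r) prefix≡F∷ʳu) (++-assoc F [ u ] (compose-from u r)))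

  backtrack : ∀ {u v} → Edge X′ u v → ∀ F Z →
    BT* X (F ++ u ∷ drop 1 (P 𝒫 u v) ++ drop 1 (P 𝒫 v u) ++ Z) (F ++ u ∷ Z)
  backtrack {u} {v} e F Z =
    subst (λ L → BT* X L (F ++ u ∷ Z))
      (cong₂ (λ p q → F ++ p ++ drop 1 q ++ Z) (path-head (P-path 𝒫 e)) (sym (P-rev 𝒫 e)))
      (path-backtrack (P-path 𝒫 e) F Z)

  compose′-bt-contract : ∀ {a} xs u v ys → Edge X′ u v → IsPath X′ a u (xs ++ [ u ]) →
    BT* X (compose′ (xs ++ u ∷ v ∷ u ∷ ys)) (compose′ (xs ++ u ∷ ys))
  compose′-bt-contract xs u v ys e p with compose′-at xs u p
  ... | F , split = subst₂ (BT* X) (sym (split (v ∷ u ∷ ys))) (sym (split ys))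
                      (backtrack e F (compose-from u ys))

  compose′-bt : ∀ {a b A B} → BT X′ A B → IsPath X′ a b A → BT* X (compose′ A) (compose′ B)
  compose′-bt (bt-contract xs ys u v e) p =
    compose′-bt-contract xs u v ys e (proj₁ (path-split xs u (v ∷ u ∷ ys) p))
  compose′-bt (bt-expand xs ys u v e) p =
    bt*-sym (compose′-bt-contract xs u v ys e (proj₁ (path-split xs u ys p)))

  compose′-bt* : ∀ {a b A B} → BT* X′ A B → IsPath X′ a b A → BT* X (compose′ A) (compose′ B)
  compose′-bt* (bt-refl _)   p = bt-refl _
  compose′-bt* (bt-cons s r) p = bt*-trans (compose′-bt s p) (compose′-bt* r (bt-path s p))

  P-++-≢-singleton : ∀ {u v} → Edge X′ u v → ∀ R → ¬ (P 𝒫 u v ++ R ≡ [ u ])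
  P-++-≢-singleton {u} {v} e R with P 𝒫 u v | P-path 𝒫 e
  ... | _ | single _ = ⊥-elim (edge-irr X′ e refl)
  ... | _ | step _ _ = λ ()

  ¬TR-if-0-contractible :
    (∀ u v w → Tri X′ u v w → HasContraction X 0 u (compose 𝒫 (u ∷ v ∷ w ∷ u ∷ []))) →
    ∀ {A B} → ¬ TR X′ A B
  ¬TR-if-0-contractible contractible (tr-expand _ _ u w v t) =
    P-++-≢-singleton (tri-edge X′ t) _ (proj₂ (contractible u w v t))
  ¬TR-if-0-contractible contractible (tr-contract _ _ u w v t) =
    P-++-≢-singleton (tri-edge X′ t) _ (proj₂ (contractible u w v t))

  module _ {m : ℕ}
    (contractible : ∀ u v w → Tri X′ u v w →
                    HasContraction X (suc m) u (compose 𝒫 (u ∷ v ∷ w ∷ u ∷ [])))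
    where

    compose′-tr-contract : ∀ {a} xs u w v ys → Tri X′ u w v → IsPath X′ a u (xs ++ [ u ]) →
      Chain X (suc m) (compose′ (xs ++ u ∷ w ∷ v ∷ ys)) (compose′ (xs ++ u ∷ v ∷ ys))
    compose′-tr-contract xs u w v ys t p =
      subst₂ (Chain X (suc m)) (sym (split (w ∷ v ∷ ys))) (sym (split (v ∷ ys)))
        (bt*-chain (bt*-sym (backtrack uv F (compose-from u (w ∷ v ∷ ys))))
          (subst₂ (Chain X (suc m)) with-cycle without-cycle
            (chain-ctx (suc m) (F ++ J) Z cycle-contraction)))
      where
      open ≡-Reasoning
      t′ : Tri X′ v u w
      t′ = tri-rot X′ (tri-rot X′ t)
      uv : Edge X′ u v
      uv = tri-edge X′ (tri-swap X′ t′)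
      F = proj₁ (compose′-at xs u p)
      split = proj₂ (compose′-at xs u p)
      J = proj₁ (path-∷ʳ (P-path 𝒫 uv))
      Z = compose-from v ys

      P-uv : u ∷ drop 1 (P 𝒫 u v) ≡ J ++ [ v ]
      P-uv = trans (sym (path-head (P-path 𝒫 uv))) (proj₂ (path-∷ʳ (P-path 𝒫 uv)))

      cycle-contraction : Chain X (suc m) (compose′ (v ∷ u ∷ w ∷ v ∷ [])) [ v ]
      cycle-contraction =
        subst (λ L → Chain X (suc m) L [ v ])
          (compose≡compose′ (step (edge-sym X′ uv) (step (tri-edge X′ t)
                             (step (tri-edge X′ (tri-rot X′ t)) (single v)))))
          (proj₂ (contractible v u w t′))

      with-cycle : (F ++ J) ++ compose′ (v ∷ u ∷ w ∷ v ∷ []) ++ Z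
                 ≡ F ++ u ∷ drop 1 (P 𝒫 u v) ++ drop 1 (P 𝒫 v u) ++ compose-from u (w ∷ v ∷ ys)
      with-cycle = begin
        (F ++ J) ++ compose′ (v ∷ u ∷ w ∷ v ∷ []) ++ Z
          ≡⟨ ++-regroup-cycle F J [ v ] (drop 1 (P 𝒫 v u)) (drop 1 (P 𝒫 u w)) (drop 1 (P 𝒫 w v)) Z ⟨
        F ++ (J ++ [ v ]) ++ drop 1 (P 𝒫 v u) ++ compose-from u (w ∷ v ∷ ys)
          ≡⟨ cong (λ q → F ++ q ++ drop 1 (P 𝒫 v u) ++ compose-from u (w ∷ v ∷ ys)) P-uv ⟨
        F ++ u ∷ drop 1 (P 𝒫 u v) ++ drop 1 (P 𝒫 v u) ++ compose-from u (w ∷ v ∷ ys)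
          ∎

      without-cycle : (F ++ J) ++ [ v ] ++ Z ≡ F ++ u ∷ compose-from u (v ∷ ys)
      without-cycle = begin
        (F ++ J) ++ [ v ] ++ Z        ≡⟨ ++-regroup F J [ v ] Z ⟨
        F ++ (J ++ [ v ]) ++ Z        ≡⟨ cong (λ q → F ++ q ++ Z) P-uv ⟨
        F ++ u ∷ drop 1 (P 𝒫 u v) ++ Z ∎

    compose′-tr : ∀ {a b A B} → TR X′ A B → IsPath X′ a b A →
      Chain X (suc m) (compose′ A) (compose′ B)
    compose′-tr (tr-expand xs ys u w v t) p =
      chain-sym (suc m) (compose′-tr-contract xs u w v ys t (proj₁ (path-split xs u (v ∷ ys) p)))
    compose′-tr (tr-contract xs ys u w v t) p =
      compose′-tr-contract xs u w v ys t (proj₁ (path-split xs u (w ∷ v ∷ ys) p))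

    compose′-∼₁ : ∀ {a b A B} → A ∼₁[ X′ ] B → IsPath X′ a b A →
      Chain X (suc m) (compose′ A) (compose′ B)
    compose′-∼₁ (_ , _ , A↝A′ , A′→B′ , B′↝B) p =
      chain-bt* m (bt*-chain (compose′-bt* A↝A′ p) (compose′-tr A′→B′ pA′))
                  (compose′-bt* B′↝B (tr-path A′→B′ pA′))
      where pA′ = bt*-path A↝A′ p

    compose′-chain : ∀ ℓ {a b C D} → IsPath X′ a b C → Chain X′ ℓ C D →
      Chain X (ℓ * suc m) (compose′ C) (compose′ D)
    compose′-chain zero    p refl               = refl
    compose′-chain (suc ℓ) p (C′ , C∼C′ , C′⇝D) =
      chain-++ (suc m) (ℓ * suc m) (compose′-∼₁ C∼C′ p) (compose′-chain ℓ (∼₁-path C∼C′ p) C′⇝D)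

    compose-contraction : ∀ ℓ {v0 C} → HasContraction X′ ℓ v0 C →
      HasContraction X (ℓ * suc m) v0 (compose 𝒫 C)
    compose-contraction ℓ {v0} (cycle , contraction) =
      compose-path cycle ,
      subst (λ L → Chain X (ℓ * suc m) L [ v0 ]) (sym (compose≡compose′ cycle))
        (compose′-chain ℓ cycle contraction)

proposition5p12 : {V : Set} (X X' : Complex V) → Subcomplex X X' →
    (𝒫 : Substitution X X') (m : ℕ) →
    (∀ u v w → Tri X' u v w →
      HasContraction X m u (compose 𝒫 (u ∷ v ∷ w ∷ u ∷ []))) →
    ∀ (ℓ : ℕ) (v0 : V) (C : List V) → HasContraction X' ℓ v0 C →
    HasContraction X (ℓ * m) v0 (compose 𝒫 C)
proposition5p12 X X' _ 𝒫 zero contractible zero v0 C (_ , refl) = single v0 , refl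
proposition5p12 X X' _ 𝒫 zero contractible (suc ℓ) v0 C (_ , _ , (_ , _ , _ , A→B , _) , _) =
  ⊥-elim (Composition.¬TR-if-0-contractible 𝒫 contractible A→B)
proposition5p12 X X' _ 𝒫 (suc m) contractible ℓ v0 C C-contraction =
  Composition.compose-contraction 𝒫 contractible ℓ C-contraction
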